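{- For any $k\ge1$ and $n\ge k$, the function $m\mapsto f_k(n,m)/m$ is non-increasing in $m\ge1$.
   Context: A random $k$-SAT formula $F_k(n,m)$ on variables $X_1,\dots,X_n$ consists of $m$ clauses, each chosen independently and uniformly at random (with replacement) from the $2^k\binom nk$ proper $k$-clauses (a proper clause is a disjunction of $k$ literals on $k$ distinct variables, each literal a variable or its negation). $\max F$ is the maximum over truth assignments of the number of clauses satisfied, and $f_k(n,m)=\mathbb{E}[\max F_k(n,m)]$. -}

module Defs where

open import Data.Nat using (ℕ; zero; suc; _⊔_)
open import Data.Bool using (Bool; true; false; not; if_then_else_; _∨_)
open import Data.Fin using (Fin)
import Data.Fin as F
open import Data.Vec using (Vec; []; _∷_; lookup)
import Data.Vec as V
open import Data.List using (List; []; _∷_; [_]; _++_; map; concatMap; cartesianProduct; length)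
open import Data.Nat.ListAction using (sum)
open import Data.Product using (_×_; _,_)
open import Data.Integer using (+_)
open import Data.Rational using (ℚ; _/_; _*_; 0ℚ)

-- k-element subsets of Fin n, as strictly increasing vectors (each subset once)
combos : (n k : ℕ) → List (Vec (Fin n) k)
combos n zero = [ [] ]
combos zero (suc k) = []
combos (suc n) (suc k) =
  map (λ v → F.zero ∷ V.map F.suc v) (combos n k) ++ map (V.map F.suc) (combos n (suc k))

-- all 2^k sign vectors (true = positive literal, false = negated literal)
signs : (k : ℕ) → List (Vec Bool k)
signs zero = [ [] ]
signs (suc k) = concatMap (λ v → (true ∷ v) ∷ (false ∷ v) ∷ []) (signs k)

-- a proper k-clause on n variables: k distinct variables (as an increasing
-- vector, i.e. a k-subset) together with a sign for each of them
Clause : ℕ → ℕ → Set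
Clause n k = Vec (Fin n) k × Vec Bool k

clauses : (n k : ℕ) → List (Clause n k)
clauses n k = cartesianProduct (combos n k) (signs k)

Assignment : ℕ → Set
Assignment n = Vec Bool n

assignments : (n : ℕ) → List (Assignment n)
assignments n = signs n

literal : ∀ {n} → Assignment n → Fin n → Bool → Bool
literal a x s = if s then lookup a x else not (lookup a x)

satisfies : ∀ {n k} → Assignment n → Clause n k → Bool
satisfies a (xs , ss) = V.foldr _ _∨_ false (V.zipWith (literal a) xs ss)

Formula : ℕ → ℕ → Set
Formula n k = List (Clause n k)

numSat : ∀ {n k} → Assignment n → Formula n k → ℕ
numSat a F = sum (map (λ c → if satisfies a c then 1 else 0) F)

maxSat : ∀ {n k} → Formula n k → ℕ
maxSat {n} F = Data.List.foldr _⊔_ 0 (map (λ a → numSat a F) (assignments n))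

-- all m-tuples of elements of a list (sampling with replacement, ordered)
tuples : ∀ {A : Set} → List A → ℕ → List (List A)
tuples xs zero = [ [] ]
tuples xs (suc m) = concatMap (λ c → map (c ∷_) (tuples xs m)) xs

-- average of a list of naturals (uniform expectation); 0 for empty list
avg : List ℕ → ℚ
avg [] = 0ℚ
avg (x ∷ xs) = (+ sum (x ∷ xs)) / length (x ∷ xs)

-- f_k(n,m) = E[max F_k(n,m)], F_k(n,m) uniform over the (2^k C(n,k))^m formulas
f : (k n m : ℕ) → ℚ
f k n m = avg (map maxSat (tuples (clauses n k) m))

-- f_k(n,m) / m  (only meaningful for m ≥ 1; set to 0 at m = 0)
fPerClause : (k n m : ℕ) → ℚ
fPerClause k n zero = 0ℚ
fPerClause k n (suc m) = f k n (suc m) * ((+ 1) / suc m)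

{-# OPTIONS --safe #-}

-- Deleting in turn each clause of a formula G with m + 1 clauses counts every clause
-- of G exactly m times, so for a fixed assignment the numbers of satisfied clauses of
-- the m + 1 shortened formulas add up to m times that of G; taking maxima,
-- m · max G ≤ Σᵢ max (G − i). For G uniform among the (m + 1)-tuples of clauses each
-- G − i is uniform among the m-tuples, so averaging gives m f(m + 1) ≤ (m + 1) f(m).
-- Nothing else about clauses is used.
module Submission where

open import Defs
open import Data.Nat using (ℕ; _≤_)
open import Data.Rational using () renaming (_≤_ to _≤ℚ_)

open import Function using (_∘_)
open import Data.Nat
  using (zero; suc; _+_; _*_; _^_; _⊔_; _≤′_; ≤′-refl; ≤′-step; z≤n; s≤s⁻¹; NonZero)
open import Data.Nat.Properties
open import Data.Nat.ListAction using (sum)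
open import Data.Nat.ListAction.Properties using (sum-++)
open import Data.Nat.Tactic.RingSolver using (solve-∀)
open import Data.List using (List; []; _∷_; _++_; map; length; concatMap; foldr)
open import Data.List.Properties using (map-++; map-∘; map-cong; length-map)
import Data.Integer as ℤ
import Data.Integer.Properties as ℤ
open import Data.Rational as ℚ using (ℚ; toℚᵘ)
import Data.Rational.Properties as ℚ
import Data.Rational.Unnormalised as ℚᵘ
import Data.Rational.Unnormalised.Properties as ℚᵘ
open import Relation.Binary.PropositionalEquality

private variable
  A B : Set

∑ : List A → (A → ℕ) → ℕ
∑ xs g = sum (map g xs)

syntax ∑ xs (λ x → e) = ∑[ x ∈ xs ] e

∑-++ : ∀ (g : A → ℕ) xs ys → ∑ (xs ++ ys) g ≡ ∑ xs g + ∑ ys g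
∑-++ g xs ys = trans (cong sum (map-++ g xs ys)) (sum-++ (map g xs) (map g ys))

∑-map : ∀ (f : A → B) (g : B → ℕ) xs → ∑ (map f xs) g ≡ ∑ xs (g ∘ f)
∑-map f g xs = cong sum (sym (map-∘ xs))

∑-concatMap : ∀ (f : A → List B) (g : B → ℕ) xs →
  ∑ (concatMap f xs) g ≡ ∑[ x ∈ xs ] ∑ (f x) g
∑-concatMap f g [] = refl
∑-concatMap f g (x ∷ xs) =
  trans (∑-++ g (f x) (concatMap f xs)) (cong (∑ (f x) g +_) (∑-concatMap f g xs))

∑-cong : ∀ {g h : A → ℕ} xs → (∀ x → g x ≡ h x) → ∑ xs g ≡ ∑ xs h
∑-cong xs g≗h = cong sum (map-cong g≗h xs)

∑-mono-≤ : ∀ {g h : A → ℕ} xs → (∀ x → g x ≤ h x) → ∑ xs g ≤ ∑ xs h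
∑-mono-≤ []       g≤h = ≤-refl
∑-mono-≤ (x ∷ xs) g≤h = +-mono-≤ (g≤h x) (∑-mono-≤ xs g≤h)

∑-+ : ∀ (g h : A → ℕ) xs → ∑[ x ∈ xs ] (g x + h x) ≡ ∑ xs g + ∑ xs h
∑-+ g h []       = refl
∑-+ g h (x ∷ xs) =
  trans (cong (g x + h x +_) (∑-+ g h xs)) (+-interchange (g x) (h x) (∑ xs g) (∑ xs h))
  where
  +-interchange : ∀ a b c d → a + b + (c + d) ≡ a + c + (b + d)
  +-interchange = solve-∀

∑-*ˡ : ∀ k (g : A → ℕ) xs → ∑[ x ∈ xs ] (k * g x) ≡ k * ∑ xs g
∑-*ˡ k g []       = sym (*-zeroʳ k)
∑-*ˡ k g (x ∷ xs) =
  trans (cong (k * g x +_) (∑-*ˡ k g xs)) (sym (*-distribˡ-+ k (g x) (∑ xs g)))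

∑-const : ∀ k (xs : List A) → ∑[ _ ∈ xs ] k ≡ length xs * k
∑-const k []       = refl
∑-const k (x ∷ xs) = cong (k +_) (∑-const k xs)

length≡∑1 : ∀ (xs : List A) → length xs ≡ ∑[ _ ∈ xs ] 1
length≡∑1 xs = sym (trans (∑-const 1 xs) (*-identityʳ (length xs)))

⨆ : List B → (B → ℕ) → ℕ
⨆ bs g = foldr _⊔_ 0 (map g bs)

syntax ⨆ bs (λ b → e) = ⨆[ b ∈ bs ] e

⨆-mono-≤ : ∀ {g h : B → ℕ} bs → (∀ b → g b ≤ h b) → ⨆ bs g ≤ ⨆ bs h
⨆-mono-≤ []       g≤h = ≤-refl
⨆-mono-≤ (b ∷ bs) g≤h = ⊔-mono-≤ (g≤h b) (⨆-mono-≤ bs g≤h)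

*-distribˡ-⨆ : ∀ k (g : B → ℕ) bs → k * ⨆ bs g ≡ ⨆[ b ∈ bs ] (k * g b)
*-distribˡ-⨆ k g []       = *-zeroʳ k
*-distribˡ-⨆ k g (b ∷ bs) =
  trans (*-distribˡ-⊔ k (g b) (⨆ bs g)) (cong (k * g b ⊔_) (*-distribˡ-⨆ k g bs))

⨆-∑-≤-∑-⨆ : ∀ (g : B → A → ℕ) bs xs →
  ⨆[ b ∈ bs ] ∑ xs (g b) ≤ ∑[ x ∈ xs ] ⨆[ b ∈ bs ] g b x
⨆-∑-≤-∑-⨆ g []       xs = z≤n
⨆-∑-≤-∑-⨆ g (b ∷ bs) xs = ⊔-lub
  (∑-mono-≤ xs (λ x → m≤m⊔n (g b x) (⨆[ b′ ∈ bs ] g b′ x)))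
  (≤-trans (⨆-∑-≤-∑-⨆ g bs xs)
           (∑-mono-≤ xs (λ x → m≤n⊔m (g b x) (⨆[ b′ ∈ bs ] g b′ x))))

deletions : List A → List (List A)
deletions []      = []
deletions (c ∷ G) = G ∷ map (c ∷_) (deletions G)

length-deletions : ∀ (G : List A) → length (deletions G) ≡ length G
length-deletions []      = refl
length-deletions (c ∷ G) = cong suc (trans (length-map (c ∷_) (deletions G)) (length-deletions G))

∑-deletions-∷ : ∀ (h : List A → ℕ) c G →
  ∑ (deletions (c ∷ G)) h ≡ h G + ∑[ D ∈ deletions G ] h (c ∷ D)
∑-deletions-∷ h c G = cong (h G +_) (∑-map (c ∷_) h (deletions G))

∑-deletions-∑ : ∀ (w : A → ℕ) G →
  ∑[ D ∈ deletions G ] ∑ D w + ∑ G w ≡ length G * ∑ G w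
∑-deletions-∑ w []      = refl
∑-deletions-∑ w (c ∷ G) = begin
  ∑[ D ∈ deletions (c ∷ G) ] ∑ D w + (x + s)
    ≡⟨ cong (_+ (x + s)) (∑-deletions-∷ (λ D → ∑ D w) c G) ⟩
  s + ∑[ D ∈ deletions G ] (x + ∑ D w) + (x + s)
    ≡⟨ cong (λ t → s + t + (x + s)) (∑-+ (λ _ → x) (λ D → ∑ D w) (deletions G)) ⟩
  s + (∑[ _ ∈ deletions G ] x + r) + (x + s)
    ≡⟨ cong (λ t → s + (t + r) + (x + s)) x-counted-g-times ⟩
  s + (g * x + r) + (x + s)
    ≡⟨ regroup s x g r ⟩
  (x + s) + (g * x + (r + s))
    ≡⟨ cong (λ t → (x + s) + (g * x + t)) (∑-deletions-∑ w G) ⟩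
  (x + s) + (g * x + g * s)
    ≡⟨ cong ((x + s) +_) (sym (*-distribˡ-+ g x s)) ⟩
  suc g * (x + s) ∎
  where
  open ≡-Reasoning
  x = w c
  s = ∑ G w
  r = ∑[ D ∈ deletions G ] ∑ D w
  g = length G
  x-counted-g-times : ∑[ _ ∈ deletions G ] x ≡ g * x
  x-counted-g-times = trans (∑-const x (deletions G)) (cong (_* x) (length-deletions G))
  regroup : ∀ s x g r → s + (g * x + r) + (x + s) ≡ (x + s) + (g * x + (r + s))
  regroup = solve-∀

LeaveOneOutSubadditive : (List A → ℕ) → Set
LeaveOneOutSubadditive h = ∀ {m} G → length G ≡ suc m → m * h G ≤ ∑ (deletions G) h

∑-leaveOneOutSubadditive : (w : A → ℕ) → LeaveOneOutSubadditive (λ G → ∑ G w)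
∑-leaveOneOutSubadditive w {m} G |G|≡1+m = ≤-reflexive (sym (+-cancelʳ-≡ (∑ G w) _ _ (begin
  ∑[ D ∈ deletions G ] ∑ D w + ∑ G w ≡⟨ ∑-deletions-∑ w G ⟩
  length G * ∑ G w                   ≡⟨ cong (_* ∑ G w) |G|≡1+m ⟩
  ∑ G w + m * ∑ G w                  ≡⟨ +-comm (∑ G w) (m * ∑ G w) ⟩
  m * ∑ G w + ∑ G w                  ∎)))
  where open ≡-Reasoning

⨆-leaveOneOutSubadditive : ∀ (h : B → List A → ℕ) bs →
  (∀ b → LeaveOneOutSubadditive (h b)) → LeaveOneOutSubadditive (λ G → ⨆[ b ∈ bs ] h b G)
⨆-leaveOneOutSubadditive h bs loo {m} G |G|≡1+m = begin
  m * ⨆[ b ∈ bs ] h b G                       ≡⟨ *-distribˡ-⨆ m (λ b → h b G) bs ⟩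
  ⨆[ b ∈ bs ] (m * h b G)                     ≤⟨ ⨆-mono-≤ bs (λ b → loo b G |G|≡1+m) ⟩
  ⨆[ b ∈ bs ] ∑ (deletions G) (h b)           ≤⟨ ⨆-∑-≤-∑-⨆ h bs (deletions G) ⟩
  ∑[ D ∈ deletions G ] ⨆[ b ∈ bs ] h b D      ∎
  where open ≤-Reasoning

maxSat-leaveOneOutSubadditive : ∀ {n k} → LeaveOneOutSubadditive (maxSat {n} {k})
maxSat-leaveOneOutSubadditive {n} =
  ⨆-leaveOneOutSubadditive numSat (assignments n) (λ a → ∑-leaveOneOutSubadditive _)

∑-tuples-suc : ∀ (xs : List A) m g →
  ∑ (tuples xs (suc m)) g ≡ ∑[ c ∈ xs ] ∑[ G ∈ tuples xs m ] g (c ∷ G)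
∑-tuples-suc xs m g =
  trans (∑-concatMap _ g xs) (∑-cong xs (λ c → ∑-map (c ∷_) g (tuples xs m)))

∑-tuples-mono-≤ : ∀ (xs : List A) m {g h : List A → ℕ} →
  (∀ G → length G ≡ m → g G ≤ h G) → ∑ (tuples xs m) g ≤ ∑ (tuples xs m) h
∑-tuples-mono-≤ xs zero    g≤h = +-monoˡ-≤ 0 (g≤h [] refl)
∑-tuples-mono-≤ xs (suc m) {g} {h} g≤h = begin
  ∑ (tuples xs (suc m)) g
    ≡⟨ ∑-tuples-suc xs m g ⟩
  ∑[ c ∈ xs ] ∑[ G ∈ tuples xs m ] g (c ∷ G)
    ≤⟨ ∑-mono-≤ xs (λ c → ∑-tuples-mono-≤ xs m (λ G → g≤h (c ∷ G) ∘ cong suc)) ⟩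
  ∑[ c ∈ xs ] ∑[ G ∈ tuples xs m ] h (c ∷ G)
    ≡⟨ ∑-tuples-suc xs m h ⟨
  ∑ (tuples xs (suc m)) h
    ∎
  where open ≤-Reasoning

length-tuples : ∀ (xs : List A) m → length (tuples xs m) ≡ length xs ^ m
length-tuples xs zero    = refl
length-tuples xs (suc m) = begin
  length (tuples xs (suc m))          ≡⟨ length≡∑1 (tuples xs (suc m)) ⟩
  ∑[ _ ∈ tuples xs (suc m) ] 1        ≡⟨ ∑-tuples-suc xs m (λ _ → 1) ⟩
  ∑[ _ ∈ xs ] ∑[ _ ∈ tuples xs m ] 1  ≡⟨ ∑-const _ xs ⟩
  length xs * ∑[ _ ∈ tuples xs m ] 1  ≡⟨ cong (length xs *_) (length≡∑1 (tuples xs m)) ⟨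
  length xs * length (tuples xs m)    ≡⟨ cong (length xs *_) (length-tuples xs m) ⟩
  length xs ^ suc m                   ∎
  where open ≡-Reasoning

∑-tuples-deletions : ∀ (xs : List A) m (h : List A → ℕ) →
  ∑[ G ∈ tuples xs (suc m) ] ∑ (deletions G) h ≡ suc m * (length xs * ∑ (tuples xs m) h)
∑-tuples-deletions xs zero h = begin
  ∑[ G ∈ tuples xs 1 ] ∑ (deletions G) h  ≡⟨ ∑-tuples-suc xs 0 _ ⟩
  ∑[ _ ∈ xs ] (h [] + 0 + 0)              ≡⟨ ∑-const _ xs ⟩
  length xs * (h [] + 0 + 0)              ≡⟨ cong (length xs *_) (+-identityʳ (h [] + 0)) ⟩
  length xs * (h [] + 0)                  ≡⟨ *-identityˡ _ ⟨
  1 * (length xs * (h [] + 0))            ∎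
  where open ≡-Reasoning
∑-tuples-deletions xs (suc m) h = begin
  ∑[ G ∈ tuples xs (2 + m) ] ∑ (deletions G) h
    ≡⟨ ∑-tuples-suc xs (suc m) _ ⟩
  ∑[ c ∈ xs ] ∑[ G ∈ T ] ∑ (deletions (c ∷ G)) h
    ≡⟨ ∑-cong xs (λ c → ∑-cong T (∑-deletions-∷ h c)) ⟩
  ∑[ c ∈ xs ] ∑[ G ∈ T ] (h G + ∑[ D ∈ deletions G ] h (c ∷ D))
    ≡⟨ ∑-cong xs (λ c → ∑-+ h _ T) ⟩
  ∑[ c ∈ xs ] (X + ∑[ G ∈ T ] ∑[ D ∈ deletions G ] h (c ∷ D))
    ≡⟨ ∑-cong xs (λ c → cong (X +_) (∑-tuples-deletions xs m (h ∘ (c ∷_)))) ⟩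
  ∑[ c ∈ xs ] (X + suc m * (N * ∑[ G ∈ tuples xs m ] h (c ∷ G)))
    ≡⟨ ∑-+ (λ _ → X) _ xs ⟩
  ∑[ _ ∈ xs ] X + ∑[ c ∈ xs ] (suc m * (N * ∑[ G ∈ tuples xs m ] h (c ∷ G)))
    ≡⟨ cong₂ _+_ (∑-const X xs) (∑-*ˡ (suc m) _ xs) ⟩
  N * X + suc m * ∑[ c ∈ xs ] (N * ∑[ G ∈ tuples xs m ] h (c ∷ G))
    ≡⟨ cong (λ t → N * X + suc m * t) (∑-*ˡ N _ xs) ⟩
  N * X + suc m * (N * ∑[ c ∈ xs ] ∑[ G ∈ tuples xs m ] h (c ∷ G))
    ≡⟨ cong (λ t → N * X + suc m * (N * t)) (∑-tuples-suc xs m h) ⟨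
  N * X + suc m * (N * X) ∎
  where
  open ≡-Reasoning
  N = length xs
  T = tuples xs (suc m)
  X = ∑ T h

∑-tuples-leaveOneOut : ∀ {h : List A → ℕ} → LeaveOneOutSubadditive h → ∀ xs m →
  m * ∑ (tuples xs (suc m)) h ≤ suc m * (length xs * ∑ (tuples xs m) h)
∑-tuples-leaveOneOut {h = h} loo xs m = begin
  m * ∑ (tuples xs (suc m)) h                   ≡⟨ ∑-*ˡ m h (tuples xs (suc m)) ⟨
  ∑[ G ∈ tuples xs (suc m) ] (m * h G)          ≤⟨ ∑-tuples-mono-≤ xs (suc m) loo ⟩
  ∑[ G ∈ tuples xs (suc m) ] ∑ (deletions G) h  ≡⟨ ∑-tuples-deletions xs m h ⟩
  suc m * (length xs * ∑ (tuples xs m) h)       ∎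
  where open ≤-Reasoning

a*d≤b*c⇒a/c≤b/d : ∀ a b c d .{{_ : NonZero c}} .{{_ : NonZero d}} →
  a * d ≤ b * c → ℤ.+ a ℚᵘ./ c ℚᵘ.≤ ℤ.+ b ℚᵘ./ d
a*d≤b*c⇒a/c≤b/d a b (suc c) (suc d) ad≤bc =
  ℚᵘ.*≤* (subst₂ ℤ._≤_ (ℤ.pos-* a (suc d)) (ℤ.pos-* b (suc c)) (ℤ.+≤+ ad≤bc))

toℚᵘ-avg-*-1/ : ∀ x (l : List ℕ) u →
  toℚᵘ (avg (x ∷ l) ℚ.* (ℤ.+ 1 ℚ./ suc u))
    ℚᵘ.≃ ℤ.+ sum (x ∷ l) ℚᵘ./ (length (x ∷ l) * suc u)
toℚᵘ-avg-*-1/ x l u = begin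
  toℚᵘ (avg (x ∷ l) ℚ.* (ℤ.+ 1 ℚ./ suc u))
    ≈⟨ ℚ.toℚᵘ-homo-* (avg (x ∷ l)) (ℤ.+ 1 ℚ./ suc u) ⟩
  toℚᵘ (avg (x ∷ l)) ℚᵘ.* toℚᵘ (ℤ.+ 1 ℚ./ suc u)
    ≈⟨ ℚᵘ.*-cong (ℚ.toℚᵘ-fromℚᵘ (ℤ.+ s ℚᵘ./ length (x ∷ l)))
                 (ℚ.toℚᵘ-fromℚᵘ (ℤ.+ 1 ℚᵘ./ suc u)) ⟩
  (ℤ.+ s ℚᵘ./ length (x ∷ l)) ℚᵘ.* (ℤ.+ 1 ℚᵘ./ suc u)
    ≡⟨ cong (ℚᵘ._/ (length (x ∷ l) * suc u)) (ℤ.*-identityʳ (ℤ.+ s)) ⟩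
  ℤ.+ s ℚᵘ./ (length (x ∷ l) * suc u) ∎
  where
  open ℚᵘ.≃-Reasoning
  s = sum (x ∷ l)

avg-*-1/-mono-≤ : ∀ (l l′ : List ℕ) u v →
  .{{_ : NonZero (length l)}} .{{_ : NonZero (length l′)}} .{{_ : NonZero u}} .{{_ : NonZero v}} →
  sum l * (length l′ * v) ≤ sum l′ * (length l * u) →
  avg l ℚ.* (ℤ.+ 1 ℚ./ u) ≤ℚ avg l′ ℚ.* (ℤ.+ 1 ℚ./ v)
avg-*-1/-mono-≤ (x ∷ l) (x′ ∷ l′) (suc u) (suc v) cross-≤ = ℚ.toℚᵘ-cancel-≤
  (ℚᵘ.≤-respˡ-≃ (ℚᵘ.≃-sym (toℚᵘ-avg-*-1/ x l u))
  (ℚᵘ.≤-respʳ-≃ (ℚᵘ.≃-sym (toℚᵘ-avg-*-1/ x′ l′ v))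
  (a*d≤b*c⇒a/c≤b/d _ _ _ _ cross-≤)))

-- E[h G]/(m + 1) for G uniform in xs^(m + 1): fPerClause k n (suc m) is
-- meanPerEntry (clauses n k) maxSat m.
meanPerEntry : List A → (List A → ℕ) → ℕ → ℚ
meanPerEntry xs h m = avg (map h (tuples xs (suc m))) ℚ.* (ℤ.+ 1 ℚ./ suc m)

meanPerEntry-suc-≤ : ∀ {h : List A → ℕ} → LeaveOneOutSubadditive h → ∀ xs m →
  meanPerEntry xs h (suc m) ≤ℚ meanPerEntry xs h m
meanPerEntry-suc-≤ loo []          m = ℚ.≤-reflexive
  (trans (ℚ.*-zeroˡ (ℤ.+ 1 ℚ./ (2 + m))) (sym (ℚ.*-zeroˡ (ℤ.+ 1 ℚ./ (1 + m)))))
meanPerEntry-suc-≤ {h = h} loo xs@(_ ∷ _) m =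
  avg-*-1/-mono-≤ (map h (tuples xs (2 + m))) (map h (tuples xs (1 + m))) (2 + m) (1 + m)
    {{nonZero-length (2 + m)}} {{nonZero-length (1 + m)}} cross-≤
  where
  N = length xs
  P = N ^ suc m
  S₁ = ∑ (tuples xs (1 + m)) h
  S₂ = ∑ (tuples xs (2 + m)) h

  length-map-tuples : ∀ j → length (map h (tuples xs j)) ≡ N ^ j
  length-map-tuples j = trans (length-map h (tuples xs j)) (length-tuples xs j)

  nonZero-length : ∀ j → NonZero (length (map h (tuples xs j)))
  nonZero-length j = subst NonZero (sym (length-map-tuples j)) (m^n≢0 N j)

  cross-≤ : S₂ * (length (map h (tuples xs (1 + m))) * (1 + m))
          ≤ S₁ * (length (map h (tuples xs (2 + m))) * (2 + m))
  cross-≤ = begin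
    S₂ * (length (map h (tuples xs (1 + m))) * (1 + m))
      ≡⟨ cong (λ L → S₂ * (L * (1 + m))) (length-map-tuples (1 + m)) ⟩
    S₂ * (P * (1 + m))    ≡⟨ rearrangeˡ S₂ P (1 + m) ⟩
    P * ((1 + m) * S₂)    ≤⟨ *-monoʳ-≤ P (∑-tuples-leaveOneOut loo xs (1 + m)) ⟩
    P * ((2 + m) * (N * S₁)) ≡⟨ rearrangeʳ P (2 + m) N S₁ ⟩
    S₁ * (N * P * (2 + m))
      ≡⟨ cong (λ L → S₁ * (L * (2 + m))) (length-map-tuples (2 + m)) ⟨
    S₁ * (length (map h (tuples xs (2 + m))) * (2 + m)) ∎
    where
    open ≤-Reasoning
    rearrangeˡ : ∀ s p k → s * (p * k) ≡ p * (k * s)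
    rearrangeˡ = solve-∀
    rearrangeʳ : ∀ p k n s → p * (k * (n * s)) ≡ s * (n * p * k)
    rearrangeʳ = solve-∀

suc-≤ℚ⇒antitone : ∀ (g : ℕ → ℚ) → (∀ m → g (suc m) ≤ℚ g m) →
  ∀ {m₁ m₂} → m₁ ≤′ m₂ → g m₂ ≤ℚ g m₁
suc-≤ℚ⇒antitone g step ≤′-refl         = ℚ.≤-refl
suc-≤ℚ⇒antitone g step (≤′-step m₁≤′m) =
  ℚ.≤-trans (step _) (suc-≤ℚ⇒antitone g step m₁≤′m)

mainTheorem6 : (k n : ℕ) → 1 ≤ k → k ≤ n →
    (m₁ m₂ : ℕ) → 1 ≤ m₁ → m₁ ≤ m₂ →
    fPerClause k n m₂ ≤ℚ fPerClause k n m₁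
mainTheorem6 k n _ _ (suc m₁) (suc m₂) _ 1+m₁≤1+m₂ =
  suc-≤ℚ⇒antitone (meanPerEntry (clauses n k) maxSat)
    (meanPerEntry-suc-≤ maxSat-leaveOneOutSubadditive (clauses n k))
    (≤⇒≤′ (s≤s⁻¹ 1+m₁≤1+m₂))
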